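{- Let $r,s$ be distinct relation variables and $A$ an attribute name. (1) There is no relational algebra expression not using the operator $\Join$ that is polymorphically equivalent to $r\Join s$, and there is no relational algebra expression not using the operator $\times$ that is polymorphically equivalent to $r\times s$. (2) There is no relational algebra expression not using any operator $\pi_{A_1,\ldots,A_n}$ that is polymorphically equivalent to $\pi_A(r)$, and there is no relational algebra expression not using any operator $\widehat\pi_B$ that is polymorphically equivalent to $\widehat\pi_A(r)$.
   Context: A type is a finite set of attribute names; a type assignment on a finite set $S$ of relation variables maps each $r\in S$ to a type. Relational algebra expressions are generated by $e \to r \mid (e\cup e)\mid (e-e)\mid (e\Join e)\mid (e\times e)\mid \sigma_{\theta(A_1,\ldots,A_n)}(e)\mid \pi_{A_1,\ldots,A_n}(e)\mid \rho_{A/B}(e)\mid \widehat{\pi}_A(e)$, with $r$ a relation variable, $A,B,A_i$ attribute names, $\theta$ a selection predicate. ${\it Relvars}(e)$ is the set of relation variables occurring in $e$. The judgment $\mathcal{T}\vdash e:\tau$ is defined inductively: $\mathcal{T}\vdash r:\mathcal{T}(r)$; if $\mathcal{T}\vdash e_1:\tau$ and $\mathcal{T}\vdash e_2:\tau$ then $\mathcal{T}\vdash (e_1\cup e_2):\tau$ and $\mathcal{T}\vdash(e_1-e_2):\tau$; if $\mathcal{T}\vdash e_1:\tau_1$, $\mathcal{T}\vdash e_2:\tau_2$ then $\mathcal{T}\vdash (e_1\Join e_2):\tau_1\cup\tau_2$, and if moreover $\tau_1\cap\tau_2=\emptyset$ then $\mathcal{T}\vdash(e_1\times e_2):\tau_1\cup\tau_2$;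 if $\mathcal{T}\vdash e:\tau$ and $A_1,\ldots,A_n\in\tau$ then $\mathcal{T}\vdash \sigma_{\theta(A_1,\ldots,A_n)}(e):\tau$ and $\mathcal{T}\vdash\pi_{A_1,\ldots,A_n}(e):\{A_1,\ldots,A_n\}$; if $\mathcal{T}\vdash e:\tau$, $A\in\tau$, $B\notin\tau$ then $\mathcal{T}\vdash\rho_{A/B}(e):(\tau-\{A\})\cup\{B\}$; if $\mathcal{T}\vdash e:\tau$ and $A\in\tau$ then $\mathcal{T}\vdash\widehat{\pi}_A(e):\tau-\{A\}$. An expression is well-typed under $\mathcal{T}$ if $\mathcal{T}\vdash e:\tau$ for some (necessarily unique) $\tau$. Semantics: fix a universe $\mathbf{U}$ of data elements. A tuple of type $\tau$ is a map $\tau\to\mathbf{U}$; a relation of type $\tau$ is a finite set of such tuples; a database of type $\mathcal{T}$ (on $S$) maps each $r\in S$ to a relation of type $\mathcal{T}(r)$. If $\mathcal{T}\vdash e:\tau$, $e$ evaluates on each database of type $\mathcal{T}$ to a relation of type $\tau$ in the standard way ($\cup,-$ set operations; $\Join$ natural join; $\times$ cartesian product; $\sigma_\theta$ selection of tuples satisfying $\theta$; $\pi_{A_1..A_n}$ projection onto $A_1,\ldots,A_n$; $\rho_{A/B}$ renames attribute $A$ to $B$; $\widehat\pi_A$ projects out attribute $A$ keeping all others). Polymorphic equivalence: each expression $e$ defines a polymorphic query, namely the family, indexed by the type assignments $\mathcal{T}$ on ${\it Relvars}(e)$ under which $e$ is well-typed, of the maps sending each database of type $\mathcal{T}$ to the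 value of $e$ on it (a relation of the output type of $e$ under $\mathcal{T}$). Two expressions $e_1,e_2$ are polymorphically equivalent if they express the same polymorphic query: they have the same relation variables, are well-typed under exactly the same type assignments, have the same output type under each such type assignment, and evaluate to the same relation on every database of that type assignment. -}

module Defs where

open import Data.Nat using (ℕ; _≡ᵇ_)
open import Data.Bool using (Bool; true; false; if_then_else_)
open import Data.List using (List; []; _∷_; _++_)
open import Data.Vec using (Vec; toList) renaming (map to vmap)
open import Data.List.Membership.Propositional using (_∈_; _∉_)
open import Data.List.Relation.Unary.All using (All)
open import Data.List.Relation.Unary.Any using (Any)
open import Data.Product using (Σ; _×_; ∃)
open import Data.Sum using (_⊎_)
open import Data.Empty using (⊥)
open import Relation.Nullary using (¬_)
open import Relation.Binary.PropositionalEquality using (_≡_)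
open import Function.Bundles using (_⇔_)

Attr : Set
Attr = ℕ

RelVar : Set
RelVar = ℕ

-- A type is a finite set of attribute names, represented by a list;
-- lists are compared as sets.
Ty : Set
Ty = List Attr

_≐_ : Ty → Ty → Set
τ ≐ σ = ∀ a → (a ∈ τ) ⇔ (a ∈ σ)

Disjoint : Ty → Ty → Set
Disjoint τ σ = ∀ a → a ∈ τ → a ∉ σ

remove : Attr → Ty → Ty
remove A [] = []
remove A (C ∷ τ) = if C ≡ᵇ A then remove A τ else (C ∷ remove A τ)

-- Type assignments (only the values on Relvars(e) matter).
TyAssign : Set
TyAssign = RelVar → Ty

data Expr (U : Set) : Set where
  var  : RelVar → Expr U
  _∪ₑ_ : Expr U → Expr U → Expr U
  _−ₑ_ : Expr U → Expr U → Expr U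
  _⋈ₑ_ : Expr U → Expr U → Expr U
  _×ₑ_ : Expr U → Expr U → Expr U
  σₑ   : {n : ℕ} → (Vec U n → Bool) → Vec Attr n → Expr U → Expr U
  πₑ   : List Attr → Expr U → Expr U
  ρₑ   : Attr → Attr → Expr U → Expr U     -- ρₑ A B e  is  ρ_{A/B}(e)
  π̂ₑ   : Attr → Expr U → Expr U

Occurs : {U : Set} → RelVar → Expr U → Set
Occurs x (var y) = x ≡ y
Occurs x (e₁ ∪ₑ e₂) = Occurs x e₁ ⊎ Occurs x e₂
Occurs x (e₁ −ₑ e₂) = Occurs x e₁ ⊎ Occurs x e₂
Occurs x (e₁ ⋈ₑ e₂) = Occurs x e₁ ⊎ Occurs x e₂
Occurs x (e₁ ×ₑ e₂) = Occurs x e₁ ⊎ Occurs x e₂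
Occurs x (σₑ θ As e) = Occurs x e
Occurs x (πₑ As e) = Occurs x e
Occurs x (ρₑ A B e) = Occurs x e
Occurs x (π̂ₑ A e) = Occurs x e

data Op : Set where
  op∪ op− op⋈ op× opσ opπ opρ opπ̂ : Op

Uses : {U : Set} → Op → Expr U → Set
Uses o (var y) = ⊥
Uses o (e₁ ∪ₑ e₂) = o ≡ op∪ ⊎ Uses o e₁ ⊎ Uses o e₂
Uses o (e₁ −ₑ e₂) = o ≡ op− ⊎ Uses o e₁ ⊎ Uses o e₂
Uses o (e₁ ⋈ₑ e₂) = o ≡ op⋈ ⊎ Uses o e₁ ⊎ Uses o e₂
Uses o (e₁ ×ₑ e₂) = o ≡ op× ⊎ Uses o e₁ ⊎ Uses o e₂
Uses o (σₑ θ As e) = o ≡ opσ ⊎ Uses o e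
Uses o (πₑ As e) = o ≡ opπ ⊎ Uses o e
Uses o (ρₑ A B e) = o ≡ opρ ⊎ Uses o e
Uses o (π̂ₑ A e) = o ≡ opπ̂ ⊎ Uses o e

data _⊢_∶_ {U : Set} (T : TyAssign) : Expr U → Ty → Set where
  t-var   : ∀ {r} → T ⊢ var r ∶ T r
  t-∪     : ∀ {e₁ e₂ τ₁ τ₂} → T ⊢ e₁ ∶ τ₁ → T ⊢ e₂ ∶ τ₂ → τ₁ ≐ τ₂ →
            T ⊢ (e₁ ∪ₑ e₂) ∶ τ₁
  t-−     : ∀ {e₁ e₂ τ₁ τ₂} → T ⊢ e₁ ∶ τ₁ → T ⊢ e₂ ∶ τ₂ → τ₁ ≐ τ₂ →
            T ⊢ (e₁ −ₑ e₂) ∶ τ₁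
  t-⋈     : ∀ {e₁ e₂ τ₁ τ₂} → T ⊢ e₁ ∶ τ₁ → T ⊢ e₂ ∶ τ₂ →
            T ⊢ (e₁ ⋈ₑ e₂) ∶ (τ₁ ++ τ₂)
  t-×     : ∀ {e₁ e₂ τ₁ τ₂} → T ⊢ e₁ ∶ τ₁ → T ⊢ e₂ ∶ τ₂ → Disjoint τ₁ τ₂ →
            T ⊢ (e₁ ×ₑ e₂) ∶ (τ₁ ++ τ₂)
  t-σ     : ∀ {n} {θ : Vec U n → Bool} {As : Vec Attr n} {e τ} →
            T ⊢ e ∶ τ → All (_∈ τ) (toList As) → T ⊢ σₑ θ As e ∶ τ
  t-π     : ∀ {As e τ} → T ⊢ e ∶ τ → All (_∈ τ) As → T ⊢ πₑ As e ∶ As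
  t-ρ     : ∀ {A B e τ} → T ⊢ e ∶ τ → A ∈ τ → B ∉ τ →
            T ⊢ ρₑ A B e ∶ (B ∷ remove A τ)
  t-π̂     : ∀ {A e τ} → T ⊢ e ∶ τ → A ∈ τ → T ⊢ π̂ₑ A e ∶ remove A τ

WellTyped : {U : Set} → TyAssign → Expr U → Set
WellTyped T e = ∃ λ τ → T ⊢ e ∶ τ

-- A tuple of type τ is represented by a total map  Attr → U  whose values
-- outside τ are irrelevant: two such maps denote the same τ-tuple iff they
-- agree on τ.  A relation of type τ is represented by a membership
-- predicate on total maps that is invariant under agreement on τ.

Tuple : Set → Set
Tuple U = Attr → U

_≈[_]_ : {U : Set} → Tuple U → Ty → Tuple U → Set
t ≈[ τ ] t' = ∀ a → a ∈ τ → t a ≡ t' a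

-- A database of type T: each relation variable r is assigned a finite
-- relation of type T r, given by a finite list of (representatives of)
-- tuples.
Database : Set → Set
Database U = RelVar → List (Tuple U)

upd : {U : Set} → Tuple U → Attr → U → Tuple U
upd t A u C = if C ≡ᵇ A then u else t C

Mem : {U : Set} → TyAssign → Database U → Expr U → Tuple U → Set
Mem T D (var r) t = Any (λ t' → t ≈[ T r ] t') (D r)
Mem T D (e₁ ∪ₑ e₂) t = Mem T D e₁ t ⊎ Mem T D e₂ t
Mem T D (e₁ −ₑ e₂) t = Mem T D e₁ t × ¬ Mem T D e₂ t
-- natural join / product: the restrictions to both operand types belong
-- to the operand values
Mem T D (e₁ ⋈ₑ e₂) t = Mem T D e₁ t × Mem T D e₂ t
Mem T D (e₁ ×ₑ e₂) t = Mem T D e₁ t × Mem T D e₂ t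
Mem T D (σₑ θ As e) t = Mem T D e t × θ (vmap t As) ≡ true
Mem T D (πₑ As e) t = ∃ λ t' → Mem T D e t' × All (λ C → t C ≡ t' C) As
Mem T D (ρₑ A B e) t = Mem T D e (upd t A (t B))
Mem T D (π̂ₑ A e) t = ∃ λ u → Mem T D e (upd t A u)

PolyEquiv : {U : Set} → Expr U → Expr U → Set
PolyEquiv e₁ e₂ =
  (∀ x → Occurs x e₁ ⇔ Occurs x e₂) ×
  (∀ T → WellTyped T e₁ ⇔ WellTyped T e₂) ×
  (∀ T τ₁ τ₂ → T ⊢ e₁ ∶ τ₁ → T ⊢ e₂ ∶ τ₂ →
     τ₁ ≐ τ₂ × (∀ (D : Database _) (t : Tuple _) → Mem T D e₁ t ⇔ Mem T D e₂ t))

-- All four claims follow from typing alone.  An attribute a that does not occur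
-- in e is never created by e: it reaches the output type only from the types of
-- certain relation variables of e, its sources.
-- (1) If every relation variable has type {a}, a ⋈-free expression has at most
-- one source, for two sources meet only under a ×, whose operands would then
-- share a; but assigning {a} to r and {b} to s makes both a and b reach the
-- output of r ⋈ s.  A ×-free expression stays well typed when b is collapsed
-- onto a, while r × s does not.  (2) With every relation variable of type {A, a},
-- a π-free expression always outputs a, and a π̂-free one that outputs a also
-- outputs a second attribute, whereas π_A(r) has type {A} and π̂_A(r) type {a}.
module Submission where

open import Defs

open import Data.Bool using (true; false; if_then_else_)
open import Data.Empty using (⊥-elim)
open import Data.List using (List; []; _∷_; map; _++_)
open import Data.List.Extrema.Nat using (max; ⊥≤max; xs≤max)
open import Data.List.Membership.Propositional using (_∈_; _∉_; find; lose)
open import Data.List.Membership.Propositional.Properties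
  using (∈-map⁺; ∈-map⁻; ∈-++⁺ˡ; ∈-++⁺ʳ; ∈-++⁻)
open import Data.List.Properties using (map-++; map-id-local)
open import Data.List.Relation.Binary.Subset.Propositional using (_⊆_)
open import Data.List.Relation.Binary.Subset.Propositional.Properties using (map⁺)
open import Data.List.Relation.Unary.All as All using (All; []; _∷_)
open import Data.List.Relation.Unary.Any using (Any; here; there)
open import Data.List.Relation.Unary.Any.Properties using (++↔; ++⁻; singleton⁻)
open import Data.Nat using (ℕ; suc; _<_; _⊔_; _≡ᵇ_; s≤s)
open import Data.Nat.Properties
  using ( _≟_; ≡ᵇ⇒≡; ≡⇒≡ᵇ; ≤-<-trans; <⇒≢; n<1+n; m<n⇒m<1+n
        ; m≤m⊔n; m≤n⊔m; m⊔n<o⇒m<o; m⊔n<o⇒n<o )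
open import Data.Product using (Σ; _×_; _,_; proj₁; ∃)
open import Data.Product using () renaming (map₁ to ×-map₁)
open import Data.Sum using (inj₁; inj₂)
open import Data.Sum.Function.Propositional using (_⊎-⇔_)
open import Data.Unit using (⊤; tt)
open import Data.Vec using (toList)
open import Function using (_∘_; id; case_of_)
open import Function.Bundles using (_⇔_; mk⇔; Equivalence)
open import Function.Construct.Composition using (_⇔-∘_)
open import Function.Construct.Symmetry using (⇔-sym)
open import Function.Properties.Inverse using (↔⇒⇔)
open import Relation.Binary.PropositionalEquality
  using (_≡_; _≢_; refl; sym; trans; cong; cong₂; subst; subst₂)
open import Relation.Nullary using (¬_; yes; no)

open Equivalence using (to; from)

private
  variable
    U : Set
    T T′ : TyAssign
    e e′ : Expr U
    τ τ′ : Ty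

if-≡ᵇ-refl : ∀ {B : Set} n {u v : B} → (if n ≡ᵇ n then u else v) ≡ u
if-≡ᵇ-refl n with n ≡ᵇ n | ≡⇒≡ᵇ n n refl
... | true  | _  = refl
... | false | ()

if-≡ᵇ-≢ : ∀ {B : Set} {m n} {u v : B} → m ≢ n → (if m ≡ᵇ n then u else v) ≡ v
if-≡ᵇ-≢ {m = m} {n} m≢n with m ≡ᵇ n | ≡ᵇ⇒≡ m n
... | true  | m≡n = ⊥-elim (m≢n (m≡n tt))
... | false | _   = refl

_[_≔_] : ∀ {B : Set} → (ℕ → B) → ℕ → B → ℕ → B
(f [ k ≔ u ]) x = if x ≡ᵇ k then u else f x

remove-≡ : ∀ A τ → remove A (A ∷ τ) ≡ remove A τ
remove-≡ A τ = if-≡ᵇ-refl A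

remove-≢ : ∀ {A C} τ → C ≢ A → remove A (C ∷ τ) ≡ C ∷ remove A τ
remove-≢ τ = if-≡ᵇ-≢

∈-remove⁺ : ∀ {A c} τ → c ≢ A → c ∈ τ → c ∈ remove A τ
∈-remove⁺ {A} (C ∷ τ) c≢A c∈ with C ≟ A | c∈
... | yes refl | here refl = ⊥-elim (c≢A refl)
... | yes refl | there c∈τ rewrite remove-≡ A τ   = ∈-remove⁺ τ c≢A c∈τ
... | no C≢A   | here refl rewrite remove-≢ τ C≢A = here refl
... | no C≢A   | there c∈τ rewrite remove-≢ τ C≢A = there (∈-remove⁺ τ c≢A c∈τ)

∈-remove⁻ : ∀ {A c} τ → c ∈ remove A τ → c ∈ τ × c ≢ A
∈-remove⁻ {A} (C ∷ τ) c∈ with C ≟ A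
... | yes refl rewrite remove-≡ A τ = ×-map₁ there (∈-remove⁻ τ c∈)
... | no C≢A rewrite remove-≢ τ C≢A with c∈
...   | here refl = here refl , C≢A
...   | there c∈′ = ×-map₁ there (∈-remove⁻ τ c∈′)

∈-remove⇔ : ∀ {A c} τ → c ≢ A → c ∈ remove A τ ⇔ c ∈ τ
∈-remove⇔ τ c≢A = mk⇔ (proj₁ ∘ ∈-remove⁻ τ) (∈-remove⁺ τ c≢A)

∈-∷-⇔ : ∀ {B c : Attr} {τ} → c ≢ B → c ∈ B ∷ τ ⇔ c ∈ τ
∈-∷-⇔ c≢B = mk⇔ (λ { (here c≡B) → ⊥-elim (c≢B c≡B) ; (there c∈τ) → c∈τ }) there

singletons-disjoint : ∀ {x y : Attr} → x ≢ y → Disjoint (x ∷ []) (y ∷ [])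
singletons-disjoint x≢y _ (here refl) (here refl) = x≢y refl

Any-++-⇔ : ∀ {B : Set} {P Q : B → Set} {xs ys zs ws} →
           Any P xs ⇔ Any Q zs → Any P ys ⇔ Any Q ws →
           Any P (xs ++ ys) ⇔ Any Q (zs ++ ws)
Any-++-⇔ xs⇔zs ys⇔ws = ↔⇒⇔ ++↔ ⇔-∘ ((xs⇔zs ⊎-⇔ ys⇔ws) ⇔-∘ ⇔-sym (↔⇒⇔ ++↔))

-- Attributes occurring in an expression

AllAttrs : (Attr → Set) → Expr U → Set
AllAttrs P (var _)     = ⊤
AllAttrs P (e₁ ∪ₑ e₂)  = AllAttrs P e₁ × AllAttrs P e₂
AllAttrs P (e₁ −ₑ e₂)  = AllAttrs P e₁ × AllAttrs P e₂
AllAttrs P (e₁ ⋈ₑ e₂)  = AllAttrs P e₁ × AllAttrs P e₂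
AllAttrs P (e₁ ×ₑ e₂)  = AllAttrs P e₁ × AllAttrs P e₂
AllAttrs P (σₑ θ As e) = All P (toList As) × AllAttrs P e
AllAttrs P (πₑ As e)   = All P As × AllAttrs P e
AllAttrs P (ρₑ A B e)  = P A × P B × AllAttrs P e
AllAttrs P (π̂ₑ A e)    = P A × AllAttrs P e

Fresh : Attr → Expr U → Set
Fresh a = AllAttrs (_≢ a)

allAttrs-map : ∀ {P Q : Attr → Set} → (∀ {A} → P A → Q A) →
               (e : Expr U) → AllAttrs P e → AllAttrs Q e
allAttrs-map f (var _)     _             = tt
allAttrs-map f (e₁ ∪ₑ e₂)  (p₁ , p₂)     = allAttrs-map f e₁ p₁ , allAttrs-map f e₂ p₂
allAttrs-map f (e₁ −ₑ e₂)  (p₁ , p₂)     = allAttrs-map f e₁ p₁ , allAttrs-map f e₂ p₂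
allAttrs-map f (e₁ ⋈ₑ e₂)  (p₁ , p₂)     = allAttrs-map f e₁ p₁ , allAttrs-map f e₂ p₂
allAttrs-map f (e₁ ×ₑ e₂)  (p₁ , p₂)     = allAttrs-map f e₁ p₁ , allAttrs-map f e₂ p₂
allAttrs-map f (σₑ θ As e) (ps , p)      = All.map f ps , allAttrs-map f e p
allAttrs-map f (πₑ As e)   (ps , p)      = All.map f ps , allAttrs-map f e p
allAttrs-map f (ρₑ A B e)  (pA , pB , p) = f pA , f pB , allAttrs-map f e p
allAttrs-map f (π̂ₑ A e)    (pA , p)      = f pA , allAttrs-map f e p

maxAttr : Expr U → Attr
maxAttr (var _)     = 0
maxAttr (e₁ ∪ₑ e₂)  = maxAttr e₁ ⊔ maxAttr e₂
maxAttr (e₁ −ₑ e₂)  = maxAttr e₁ ⊔ maxAttr e₂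
maxAttr (e₁ ⋈ₑ e₂)  = maxAttr e₁ ⊔ maxAttr e₂
maxAttr (e₁ ×ₑ e₂)  = maxAttr e₁ ⊔ maxAttr e₂
maxAttr (σₑ θ As e) = max (maxAttr e) (toList As)
maxAttr (πₑ As e)   = max (maxAttr e) As
maxAttr (ρₑ A B e)  = A ⊔ (B ⊔ maxAttr e)
maxAttr (π̂ₑ A e)    = A ⊔ maxAttr e

allAttrs-<-maxAttr : ∀ {n} (e : Expr U) → maxAttr e < n → AllAttrs (_< n) e
allAttrs-<-maxAttr (var _)     _     = tt
allAttrs-<-maxAttr (e₁ ∪ₑ e₂)  max<n =
  allAttrs-<-maxAttr e₁ (m⊔n<o⇒m<o _ _ max<n) , allAttrs-<-maxAttr e₂ (m⊔n<o⇒n<o _ _ max<n)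
allAttrs-<-maxAttr (e₁ −ₑ e₂)  max<n =
  allAttrs-<-maxAttr e₁ (m⊔n<o⇒m<o _ _ max<n) , allAttrs-<-maxAttr e₂ (m⊔n<o⇒n<o _ _ max<n)
allAttrs-<-maxAttr (e₁ ⋈ₑ e₂)  max<n =
  allAttrs-<-maxAttr e₁ (m⊔n<o⇒m<o _ _ max<n) , allAttrs-<-maxAttr e₂ (m⊔n<o⇒n<o _ _ max<n)
allAttrs-<-maxAttr (e₁ ×ₑ e₂)  max<n =
  allAttrs-<-maxAttr e₁ (m⊔n<o⇒m<o _ _ max<n) , allAttrs-<-maxAttr e₂ (m⊔n<o⇒n<o _ _ max<n)
allAttrs-<-maxAttr (σₑ θ As e) max<n =
  All.map (λ ≤max → ≤-<-trans ≤max max<n) (xs≤max _ (toList As)) ,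
  allAttrs-<-maxAttr e (≤-<-trans (⊥≤max _ (toList As)) max<n)
allAttrs-<-maxAttr (πₑ As e)   max<n = All.map (λ ≤max → ≤-<-trans ≤max max<n) (xs≤max _ As) ,
  allAttrs-<-maxAttr e (≤-<-trans (⊥≤max _ As) max<n)
allAttrs-<-maxAttr (ρₑ A B e)  max<n = m⊔n<o⇒m<o A _ max<n , m⊔n<o⇒m<o B _ (m⊔n<o⇒n<o A _ max<n) ,
  allAttrs-<-maxAttr e (m⊔n<o⇒n<o B _ (m⊔n<o⇒n<o A _ max<n))
allAttrs-<-maxAttr (π̂ₑ A e)    max<n = m⊔n<o⇒m<o A _ max<n , allAttrs-<-maxAttr e (m⊔n<o⇒n<o A _ max<n)

fresh : ∀ {a} (e : Expr U) → maxAttr e < a → Fresh a e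
fresh e = allAttrs-map <⇒≢ e ∘ allAttrs-<-maxAttr e

-- Sources of fresh attributes

-- The relation variables from whose types an attribute not occurring in e can
-- reach the output type of e.
sources : Expr U → List RelVar
sources (var r)     = r ∷ []
sources (e₁ ∪ₑ e₂)  = sources e₁
sources (e₁ −ₑ e₂)  = sources e₁
sources (e₁ ⋈ₑ e₂)  = sources e₁ ++ sources e₂
sources (e₁ ×ₑ e₂)  = sources e₁ ++ sources e₂
sources (σₑ θ As e) = sources e
sources (πₑ As e)   = []
sources (ρₑ A B e)  = sources e
sources (π̂ₑ A e)    = sources e

∈-type⇔Any-sources : ∀ {a} → T ⊢ e ∶ τ → Fresh a e →
                     a ∈ τ ⇔ Any (λ x → a ∈ T x) (sources e)
∈-type⇔Any-sources t-var           _         = mk⇔ here singleton⁻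
∈-type⇔Any-sources (t-∪ ⊢₁ _ _)    (f₁ , _)  = ∈-type⇔Any-sources ⊢₁ f₁
∈-type⇔Any-sources (t-− ⊢₁ _ _)    (f₁ , _)  = ∈-type⇔Any-sources ⊢₁ f₁
∈-type⇔Any-sources (t-⋈ ⊢₁ ⊢₂)     (f₁ , f₂) =
  Any-++-⇔ (∈-type⇔Any-sources ⊢₁ f₁) (∈-type⇔Any-sources ⊢₂ f₂)
∈-type⇔Any-sources (t-× ⊢₁ ⊢₂ _)   (f₁ , f₂) =
  Any-++-⇔ (∈-type⇔Any-sources ⊢₁ f₁) (∈-type⇔Any-sources ⊢₂ f₂)
∈-type⇔Any-sources (t-σ ⊢ _)       (_ , f)   = ∈-type⇔Any-sources ⊢ f
∈-type⇔Any-sources (t-π ⊢ _)       (fAs , _) = mk⇔ (λ a∈As → ⊥-elim (All.lookup fAs a∈As refl)) λ ()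
∈-type⇔Any-sources (t-ρ {τ = τ} ⊢ _ _) (fA , fB , f) =
  ∈-type⇔Any-sources ⊢ f ⇔-∘ (∈-remove⇔ τ (fA ∘ sym) ⇔-∘ ∈-∷-⇔ (fB ∘ sym))
∈-type⇔Any-sources (t-π̂ {τ = τ} ⊢ _)   (fA , f) = ∈-type⇔Any-sources ⊢ f ⇔-∘ ∈-remove⇔ τ (fA ∘ sym)

source⇒∈-type : ∀ {a x} → T ⊢ e ∶ τ → Fresh a e → x ∈ sources e → a ∈ T x → a ∈ τ
source⇒∈-type ⊢ f x∈ a∈Tx = from (∈-type⇔Any-sources ⊢ f) (lose x∈ a∈Tx)

⋈-free⇒sources-unique : ∀ {a} → T ⊢ e ∶ τ → ¬ Uses op⋈ e → Fresh a e → (∀ x → a ∈ T x) →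
                        ∀ {x y} → x ∈ sources e → y ∈ sources e → x ≡ y
⋈-free⇒sources-unique t-var        _  _        _ (here refl) (here refl) = refl
⋈-free⇒sources-unique (t-∪ ⊢₁ _ _) ⋈∉ (f₁ , _) a∈T =
  ⋈-free⇒sources-unique ⊢₁ (⋈∉ ∘ inj₂ ∘ inj₁) f₁ a∈T
⋈-free⇒sources-unique (t-− ⊢₁ _ _) ⋈∉ (f₁ , _) a∈T =
  ⋈-free⇒sources-unique ⊢₁ (⋈∉ ∘ inj₂ ∘ inj₁) f₁ a∈T
⋈-free⇒sources-unique (t-⋈ _ _)    ⋈∉ _        _   = ⊥-elim (⋈∉ (inj₁ refl))
⋈-free⇒sources-unique {a = a} (t-× {e₁ = e₁} ⊢₁ ⊢₂ disjoint) ⋈∉ (f₁ , f₂) a∈T x∈ y∈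
  with ++⁻ (sources e₁) x∈ | ++⁻ (sources e₁) y∈
... | inj₁ x∈₁ | inj₁ y∈₁ = ⋈-free⇒sources-unique ⊢₁ (⋈∉ ∘ inj₂ ∘ inj₁) f₁ a∈T x∈₁ y∈₁
... | inj₂ x∈₂ | inj₂ y∈₂ = ⋈-free⇒sources-unique ⊢₂ (⋈∉ ∘ inj₂ ∘ inj₂) f₂ a∈T x∈₂ y∈₂
... | inj₁ x∈₁ | inj₂ y∈₂ =
  ⊥-elim (disjoint a (source⇒∈-type ⊢₁ f₁ x∈₁ (a∈T _)) (source⇒∈-type ⊢₂ f₂ y∈₂ (a∈T _)))
... | inj₂ x∈₂ | inj₁ y∈₁ =
  ⊥-elim (disjoint a (source⇒∈-type ⊢₁ f₁ y∈₁ (a∈T _)) (source⇒∈-type ⊢₂ f₂ x∈₂ (a∈T _)))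
⋈-free⇒sources-unique (t-σ ⊢ _)    ⋈∉ (_ , f)     a∈T = ⋈-free⇒sources-unique ⊢ (⋈∉ ∘ inj₂) f a∈T
⋈-free⇒sources-unique (t-π ⊢ _)    _  _           _   ()
⋈-free⇒sources-unique (t-ρ ⊢ _ _)  ⋈∉ (_ , _ , f) a∈T = ⋈-free⇒sources-unique ⊢ (⋈∉ ∘ inj₂) f a∈T
⋈-free⇒sources-unique (t-π̂ ⊢ _)    ⋈∉ (_ , f)     a∈T = ⋈-free⇒sources-unique ⊢ (⋈∉ ∘ inj₂) f a∈T

⋈-free⇒single-source : ∀ {a b} → T′ ⊢ e ∶ τ′ → (∀ x → a ∈ T′ x) →
                       ¬ Uses op⋈ e → Fresh a e → Fresh b e →
                       T ⊢ e ∶ τ → a ∈ τ → b ∈ τ → ∃ λ x → a ∈ T x × b ∈ T x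
⋈-free⇒single-source ⊢′ a∈T′ ⋈∉ fa fb ⊢ a∈τ b∈τ
  with find (to (∈-type⇔Any-sources ⊢ fa) a∈τ) | find (to (∈-type⇔Any-sources ⊢ fb) b∈τ)
... | x , x∈ , a∈Tx | y , y∈ , b∈Ty with ⋈-free⇒sources-unique ⊢′ ⋈∉ fa a∈T′ x∈ y∈
... | refl = x , a∈Tx , b∈Ty

-- Attributes forced into the output type

π-free⇒∈-type : ∀ {a} → T ⊢ e ∶ τ → ¬ Uses opπ e → Fresh a e → (∀ x → a ∈ T x) → a ∈ τ
π-free⇒∈-type t-var          _  _        a∈T = a∈T _
π-free⇒∈-type (t-∪ ⊢₁ _ _)   π∉ (f₁ , _) a∈T = π-free⇒∈-type ⊢₁ (π∉ ∘ inj₂ ∘ inj₁) f₁ a∈T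
π-free⇒∈-type (t-− ⊢₁ _ _)   π∉ (f₁ , _) a∈T = π-free⇒∈-type ⊢₁ (π∉ ∘ inj₂ ∘ inj₁) f₁ a∈T
π-free⇒∈-type (t-⋈ ⊢₁ _)     π∉ (f₁ , _) a∈T = ∈-++⁺ˡ (π-free⇒∈-type ⊢₁ (π∉ ∘ inj₂ ∘ inj₁) f₁ a∈T)
π-free⇒∈-type (t-× ⊢₁ _ _)   π∉ (f₁ , _) a∈T = ∈-++⁺ˡ (π-free⇒∈-type ⊢₁ (π∉ ∘ inj₂ ∘ inj₁) f₁ a∈T)
π-free⇒∈-type (t-σ ⊢ _)      π∉ (_ , f)  a∈T = π-free⇒∈-type ⊢ (π∉ ∘ inj₂) f a∈T
π-free⇒∈-type (t-π _ _)      π∉ _        _   = ⊥-elim (π∉ (inj₁ refl))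
π-free⇒∈-type (t-ρ {τ = τ} ⊢ _ _) π∉ (fA , _ , f) a∈T =
  there (∈-remove⁺ τ (fA ∘ sym) (π-free⇒∈-type ⊢ (π∉ ∘ inj₂) f a∈T))
π-free⇒∈-type (t-π̂ {τ = τ} ⊢ _)   π∉ (fA , f)     a∈T =
  ∈-remove⁺ τ (fA ∘ sym) (π-free⇒∈-type ⊢ (π∉ ∘ inj₂) f a∈T)

OtherThan : Attr → Ty → Set
OtherThan a τ = ∃ λ c → c ∈ τ × c ≢ a

OtherThan-mono : ∀ {a σ} → τ ⊆ σ → OtherThan a τ → OtherThan a σ
OtherThan-mono τ⊆σ (c , c∈τ , c≢a) = c , τ⊆σ c∈τ , c≢a

π̂-free⇒OtherThan : ∀ {a} → T ⊢ e ∶ τ → ¬ Uses opπ̂ e → Fresh a e →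
                   (∀ x → OtherThan a (T x)) → a ∈ τ → OtherThan a τ
π̂-free⇒OtherThan t-var        _  _         other _  = other _
π̂-free⇒OtherThan (t-∪ ⊢₁ _ _) π̂∉ (f₁ , _)  other a∈ =
  π̂-free⇒OtherThan ⊢₁ (π̂∉ ∘ inj₂ ∘ inj₁) f₁ other a∈
π̂-free⇒OtherThan (t-− ⊢₁ _ _) π̂∉ (f₁ , _)  other a∈ =
  π̂-free⇒OtherThan ⊢₁ (π̂∉ ∘ inj₂ ∘ inj₁) f₁ other a∈
π̂-free⇒OtherThan (t-⋈ {τ₁ = τ₁} ⊢₁ ⊢₂) π̂∉ (f₁ , f₂) other a∈ with ∈-++⁻ τ₁ a∈
... | inj₁ a∈₁ = OtherThan-mono ∈-++⁺ˡ (π̂-free⇒OtherThan ⊢₁ (π̂∉ ∘ inj₂ ∘ inj₁) f₁ other a∈₁)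
... | inj₂ a∈₂ = OtherThan-mono (∈-++⁺ʳ τ₁) (π̂-free⇒OtherThan ⊢₂ (π̂∉ ∘ inj₂ ∘ inj₂) f₂ other a∈₂)
π̂-free⇒OtherThan (t-× {τ₁ = τ₁} ⊢₁ ⊢₂ _) π̂∉ (f₁ , f₂) other a∈ with ∈-++⁻ τ₁ a∈
... | inj₁ a∈₁ = OtherThan-mono ∈-++⁺ˡ (π̂-free⇒OtherThan ⊢₁ (π̂∉ ∘ inj₂ ∘ inj₁) f₁ other a∈₁)
... | inj₂ a∈₂ = OtherThan-mono (∈-++⁺ʳ τ₁) (π̂-free⇒OtherThan ⊢₂ (π̂∉ ∘ inj₂ ∘ inj₂) f₂ other a∈₂)
π̂-free⇒OtherThan (t-σ ⊢ _)    π̂∉ (_ , f)   other a∈ = π̂-free⇒OtherThan ⊢ (π̂∉ ∘ inj₂) f other a∈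
π̂-free⇒OtherThan (t-π _ _)    _  (fAs , _) _     a∈ = ⊥-elim (All.lookup fAs a∈ refl)
π̂-free⇒OtherThan (t-ρ {A = A} {B} {τ = τ} ⊢ _ _) π̂∉ (_ , fB , f) other a∈
  with π̂-free⇒OtherThan ⊢ (π̂∉ ∘ inj₂) f other (proj₁ (∈-remove⁻ τ (to (∈-∷-⇔ (fB ∘ sym)) a∈)))
... | c , c∈τ , c≢a with c ≟ A
...   | yes _  = B , here refl , fB
...   | no c≢A = c , there (∈-remove⁺ τ c≢A c∈τ) , c≢a
π̂-free⇒OtherThan (t-π̂ _ _)    π̂∉ _         _     _  = ⊥-elim (π̂∉ (inj₁ refl))

-- Renaming attributes

retype : τ ≡ τ′ → T ⊢ e ∶ τ → T ⊢ e ∶ τ′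
retype refl ⊢ = ⊢

Rigid : (Attr → Attr) → Attr → Set
Rigid h A = ∀ C → h C ≡ A ⇔ C ≡ A

module _ {h : Attr → Attr} where

  rigid-fixed : ∀ {A} → Rigid h A → h A ≡ A
  rigid-fixed {A} rigid = from (rigid A) refl

  ∈-map-rigid : ∀ {A} → Rigid h A → A ∈ τ → A ∈ map h τ
  ∈-map-rigid rigid A∈τ = subst (_∈ _) (rigid-fixed rigid) (∈-map⁺ h A∈τ)

  ∉-map-rigid : ∀ {A} → Rigid h A → A ∉ τ → A ∉ map h τ
  ∉-map-rigid {τ = τ} rigid A∉τ A∈hτ with ∈-map⁻ h A∈hτ
  ... | C , C∈τ , A≡hC = A∉τ (subst (_∈ τ) (to (rigid C) (sym A≡hC)) C∈τ)

  remove-map-rigid : ∀ {A} → Rigid h A → ∀ τ → remove A (map h τ) ≡ map h (remove A τ)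
  remove-map-rigid         rigid []      = refl
  remove-map-rigid {A = A} rigid (C ∷ τ) with C ≟ A
  ... | yes refl rewrite rigid-fixed rigid | remove-≡ A (map h τ) | remove-≡ A τ =
    remove-map-rigid rigid τ
  ... | no C≢A rewrite remove-≢ (map h τ) (C≢A ∘ to (rigid C)) | remove-≢ τ C≢A =
    cong (h C ∷_) (remove-map-rigid rigid τ)

  ≐-map : τ ≐ τ′ → map h τ ≐ map h τ′
  ≐-map τ≐τ′ _ = mk⇔ (map⁺ h (to (τ≐τ′ _))) (map⁺ h (from (τ≐τ′ _)))

  All-∈-map-rigid : ∀ {As} → All (Rigid h) As → All (_∈ τ) As → All (_∈ map h τ) As
  All-∈-map-rigid rigid As⊆τ = All.zipWith (λ (r , A∈τ) → ∈-map-rigid r A∈τ) (rigid , As⊆τ)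

  -- × is excluded because a non-injective h need not preserve disjointness.
  ⊢-map-rigid : T ⊢ e ∶ τ → ¬ Uses op× e → AllAttrs (Rigid h) e → (map h ∘ T) ⊢ e ∶ map h τ
  ⊢-map-rigid t-var ×∉ _ = t-var
  ⊢-map-rigid (t-∪ ⊢₁ ⊢₂ τ₁≐τ₂) ×∉ (r₁ , r₂) =
    t-∪ (⊢-map-rigid ⊢₁ (×∉ ∘ inj₂ ∘ inj₁) r₁) (⊢-map-rigid ⊢₂ (×∉ ∘ inj₂ ∘ inj₂) r₂) (≐-map τ₁≐τ₂)
  ⊢-map-rigid (t-− ⊢₁ ⊢₂ τ₁≐τ₂) ×∉ (r₁ , r₂) =
    t-− (⊢-map-rigid ⊢₁ (×∉ ∘ inj₂ ∘ inj₁) r₁) (⊢-map-rigid ⊢₂ (×∉ ∘ inj₂ ∘ inj₂) r₂) (≐-map τ₁≐τ₂)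
  ⊢-map-rigid (t-⋈ {τ₁ = τ₁} {τ₂} ⊢₁ ⊢₂) ×∉ (r₁ , r₂) =
    retype (sym (map-++ h τ₁ τ₂))
      (t-⋈ (⊢-map-rigid ⊢₁ (×∉ ∘ inj₂ ∘ inj₁) r₁) (⊢-map-rigid ⊢₂ (×∉ ∘ inj₂ ∘ inj₂) r₂))
  ⊢-map-rigid (t-× _ _ _) ×∉ _ = ⊥-elim (×∉ (inj₁ refl))
  ⊢-map-rigid (t-σ ⊢ As⊆τ) ×∉ (rAs , r) =
    t-σ (⊢-map-rigid ⊢ (×∉ ∘ inj₂) r) (All-∈-map-rigid rAs As⊆τ)
  ⊢-map-rigid (t-π ⊢ As⊆τ) ×∉ (rAs , r) =
    retype (sym (map-id-local (All.map rigid-fixed rAs)))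
      (t-π (⊢-map-rigid ⊢ (×∉ ∘ inj₂) r) (All-∈-map-rigid rAs As⊆τ))
  ⊢-map-rigid (t-ρ {τ = τ} ⊢ A∈τ B∉τ) ×∉ (rA , rB , r) =
    retype (cong₂ _∷_ (sym (rigid-fixed rB)) (remove-map-rigid rA τ))
      (t-ρ (⊢-map-rigid ⊢ (×∉ ∘ inj₂) r) (∈-map-rigid rA A∈τ) (∉-map-rigid rB B∉τ))
  ⊢-map-rigid (t-π̂ {τ = τ} ⊢ A∈τ) ×∉ (rA , r) =
    retype (remove-map-rigid rA τ) (t-π̂ (⊢-map-rigid ⊢ (×∉ ∘ inj₂) r) (∈-map-rigid rA A∈τ))

collapse-rigid : ∀ {a b C} → C ≢ a → C ≢ b → Rigid (id [ b ≔ a ]) C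
collapse-rigid {a} {b} C≢a C≢b D with D ≟ b
... | yes refl =
  mk⇔ (λ a≡C → ⊥-elim (C≢a (sym (trans (sym (if-≡ᵇ-refl D)) a≡C)))) (λ D≡C → ⊥-elim (C≢b (sym D≡C)))
... | no D≢b = mk⇔ (trans (sym (if-≡ᵇ-≢ D≢b))) (trans (if-≡ᵇ-≢ D≢b))

typing-transfer : PolyEquiv e e′ → T ⊢ e′ ∶ τ′ → ∃ λ τ → T ⊢ e ∶ τ × τ ≐ τ′
typing-transfer (_ , wt , sem) ⊢′ with from (wt _) (_ , ⊢′)
... | τ , ⊢ = τ , ⊢ , proj₁ (sem _ _ _ ⊢ ⊢′)

module _ {U : Set} {r s : RelVar} (r≢s : r ≢ s) (e : Expr U) where

  private
    a b : Attr
    a = suc (maxAttr e)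
    b = suc a

    a≢b : a ≢ b
    a≢b = <⇒≢ (n<1+n a)

    tag : RelVar → Attr
    tag = (λ _ → b) [ r ≔ a ]

    tag-r≡a : tag r ≡ a
    tag-r≡a = if-≡ᵇ-refl r

    tag-s≡b : tag s ≡ b
    tag-s≡b = if-≡ᵇ-≢ (r≢s ∘ sym)

  join-needs-⋈ : ¬ Uses op⋈ e → ¬ PolyEquiv e (var r ⋈ₑ var s)
  join-needs-⋈ ⋈∉ e≈r⋈s =
    let (_ , ⊢ᵤ , _)   = typing-transfer {T = λ _ → a ∷ []} e≈r⋈s (t-⋈ t-var t-var)
        (τ , ⊢ , τ≐ab) = typing-transfer {T = λ x → tag x ∷ []} e≈r⋈s (t-⋈ t-var t-var)
        (x , a∈tag-x , b∈tag-x) =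
          ⋈-free⇒single-source ⊢ᵤ (λ _ → here refl) ⋈∉
            (fresh e (n<1+n _)) (fresh e (m<n⇒m<1+n (n<1+n _))) ⊢
            (from (τ≐ab a) (here (sym tag-r≡a))) (from (τ≐ab b) (there (here (sym tag-s≡b))))
    in a≢b (trans (singleton⁻ a∈tag-x) (sym (singleton⁻ b∈tag-x)))

  product-needs-× : ¬ Uses op× e → ¬ PolyEquiv e (var r ×ₑ var s)
  product-needs-× ×∉ e≈r×s@(_ , typable⇔ , _) =
    let tags-disjoint = singletons-disjoint (subst₂ _≢_ (sym tag-r≡a) (sym tag-s≡b) a≢b)
        (_ , ⊢ , _) = typing-transfer {T = λ x → tag x ∷ []} e≈r×s (t-× t-var t-var tags-disjoint)
        ⊢collapsed = ⊢-map-rigid ⊢ ×∉ (allAttrs-map below-a⇒rigid e (allAttrs-<-maxAttr e (n<1+n _)))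
    in case to (typable⇔ _) (_ , ⊢collapsed) of λ where
         (_ , t-× t-var t-var disjoint) → disjoint a (here (sym collapsed-r)) (here (sym collapsed-s))
    where
    collapse : Attr → Attr
    collapse = id [ b ≔ a ]

    below-a⇒rigid : ∀ {C} → C < a → Rigid collapse C
    below-a⇒rigid C<a = collapse-rigid (<⇒≢ C<a) (<⇒≢ (m<n⇒m<1+n C<a))

    collapsed-r : collapse (tag r) ≡ a
    collapsed-r = trans (cong collapse tag-r≡a) (if-≡ᵇ-≢ a≢b)

    collapsed-s : collapse (tag s) ≡ a
    collapsed-s = trans (cong collapse tag-s≡b) (if-≡ᵇ-refl b)

module _ {U : Set} {r : RelVar} (A : Attr) (e : Expr U) where

  private
    a : Attr
    a = suc (maxAttr e ⊔ A)

    A≢a : A ≢ a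
    A≢a = <⇒≢ (s≤s (m≤n⊔m _ A))

    a-fresh : Fresh a e
    a-fresh = fresh e (s≤s (m≤m⊔n _ A))

  projection-needs-π : ¬ Uses opπ e → ¬ PolyEquiv e (πₑ (A ∷ []) (var r))
  projection-needs-π π∉ e≈πAr =
    let (τ , ⊢ , τ≐A) = typing-transfer {T = λ _ → A ∷ a ∷ []} e≈πAr (t-π t-var (here refl ∷ []))
        a∈τ = π-free⇒∈-type ⊢ π∉ a-fresh (λ _ → there (here refl))
    in A≢a (sym (singleton⁻ (to (τ≐A a) a∈τ)))

  projection-out-needs-π̂ : ¬ Uses opπ̂ e → ¬ PolyEquiv e (π̂ₑ A (var r))
  projection-out-needs-π̂ π̂∉ e≈π̂Ar =
    let (τ , ⊢ , τ≐a) = typing-transfer {T = λ _ → A ∷ a ∷ []} e≈π̂Ar (t-π̂ t-var (here refl))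
        a∈τ = from (τ≐a a) (∈-remove⁺ (A ∷ a ∷ []) (A≢a ∘ sym) (there (here refl)))
        (c , c∈τ , c≢a) = π̂-free⇒OtherThan ⊢ π̂∉ a-fresh (λ _ → A , here refl , A≢a) a∈τ
        (c∈Aa , c≢A) = ∈-remove⁻ (A ∷ a ∷ []) (to (τ≐a c) c∈τ)
    in c≢a (singleton⁻ (to (∈-∷-⇔ c≢A) c∈Aa))

proposition2 : (U : Set) → U → (r s : RelVar) → r ≢ s → (A : Attr) →
    ((¬ Σ (Expr U) (λ e → ¬ Uses op⋈ e × PolyEquiv e (var r ⋈ₑ var s))) ×
     (¬ Σ (Expr U) (λ e → ¬ Uses op× e × PolyEquiv e (var r ×ₑ var s)))) ×
    ((¬ Σ (Expr U) (λ e → ¬ Uses opπ e × PolyEquiv e (πₑ (A ∷ []) (var r)))) ×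
     (¬ Σ (Expr U) (λ e → ¬ Uses opπ̂ e × PolyEquiv e (π̂ₑ A (var r)))))
proposition2 U _ r s r≢s A = ( (λ (e , ⋈∉ , e≈r⋈s) → join-needs-⋈ r≢s e ⋈∉ e≈r⋈s)
  , (λ (e , ×∉ , e≈r×s) → product-needs-× r≢s e ×∉ e≈r×s) )
  , ( (λ (e , π∉ , e≈πAr) → projection-needs-π A e π∉ e≈πAr)
    , (λ (e , π̂∉ , e≈π̂Ar) → projection-out-needs-π̂ A e π̂∉ e≈π̂Ar) )
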